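{- A family of structures $\mathfrak{K}$ is $\mathbf{nUs}$-learnable if and only if it is $\mathbf{Dec}$-learnable.
   Context: All structures are countable, have domain $\mathbb{N}$, and are in a finite relational signature; a structure is identified with its atomic diagram in $2^{\mathbb{N}}$. $\mathcal{S}\restriction_s$ denotes the finite substructure of $\mathcal{S}$ on $\{0,\dots,s\}$. A family of structures $\mathfrak{K}$ is a countable set of pairwise nonisomorphic countable structures; $\mathrm{LD}(\mathfrak{K})$ is the set of all structures isomorphic to a member of $\mathfrak{K}$; $\mathrm{HS}(\mathfrak{K})=\{\ulcorner\mathcal{A}\urcorner:\mathcal{A}\in\mathfrak{K}\}\cup\{?\}$ (distinct formal symbols). A learner is an arbitrary function $\mathbf{M}$ from $\{\mathcal{S}\restriction_s:\mathcal{S}\in\mathrm{LD}(\mathfrak{K})\}$ to $\mathrm{HS}(\mathfrak{K})$. $\mathbf{M}$ $\mathbf{Ex}$-learns $\mathfrak{K}$ if for all $\mathcal{S}\in\mathrm{LD}(\mathfrak{K})$, $\mathcal{A}\in\mathfrak{K}$: $\lim_n\mathbf{M}(\mathcal{S}\restriction_n)=\ulcorner\mathcal{A}\urcorner$ iff $\mathcal{S}\cong\mathcal{A}$. $\mathbf{M}$ $\mathbf{nUs}$-learns (non-U-shaped) $\mathfrak{K}$ if it $\mathbf{Ex}$-learns $\mathfrak{K}$ and for every $\mathcal{S}\in\mathrm{LD}(\mathfrak{K})$ with $\mathcal{S}\cong\mathcal{A}\in\mathfrak{K}$, if $n_0$ is least with $\mathbf{M}(\mathcal{S}\restriction_{n_0})=\ulcorner\mathcal{A}\urcorner$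 then $\mathbf{M}(\mathcal{S}\restriction_m)=\ulcorner\mathcal{A}\urcorner$ for all $m>n_0$. $\mathbf{M}$ $\mathbf{Dec}$-learns (decisive) $\mathfrak{K}$ if it $\mathbf{Ex}$-learns $\mathfrak{K}$ and for every $\mathcal{S}\in\mathrm{LD}(\mathfrak{K})$, every $\mathcal{A}\in\mathfrak{K}$ and every $n$: if $\mathbf{M}(\mathcal{S}\restriction_n)=\ulcorner\mathcal{A}\urcorner$ and $\mathbf{M}(\mathcal{S}\restriction_{n+1})\neq\ulcorner\mathcal{A}\urcorner$, then $\mathbf{M}(\mathcal{S}\restriction_m)\neq\ulcorner\mathcal{A}\urcorner$ for all $m>n$. A family is $\mathbf{X}$-learnable if some learner $\mathbf{X}$-learns it. -}

module Defs where

open import Data.Nat using (ℕ; suc; _<_; _+_)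
open import Data.Fin using (Fin; toℕ)
open import Data.Vec using (Vec; []; _∷_; tabulate)
import Data.Vec as Vec
open import Data.List using (List; [_]; concatMap; map; allFin)
open import Data.Bool using (Bool)
open import Data.Maybe using (Maybe; just; nothing)
open import Data.Product using (Σ; _×_; _,_)
open import Relation.Binary.PropositionalEquality using (_≡_; _≢_)
open import Relation.Nullary using (¬_)
open import Function.Definitions using (Injective)
open import Function.Bundles using (_⇔_)

record Signature : Set where
  field
    nSym : ℕ
    ar   : Fin nSym → ℕ
open Signature public

-- A countable structure with domain ℕ: the truth value of each atomic fact
-- R_r(x₁,…,x_k).  (Equivalent to its atomic diagram in 2^ℕ.)
Structure : Signature → Set
Structure σ = (r : Fin (nSym σ)) → Vec ℕ (ar σ r) → Bool

record _≅_ {σ : Signature} (A B : Structure σ) : Set where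
  field
    f     : ℕ → ℕ
    g     : ℕ → ℕ
    gf    : ∀ x → g (f x) ≡ x
    fg    : ∀ y → f (g y) ≡ y
    pres  : ∀ r (t : Vec ℕ (ar σ r)) → A r t ≡ B r (Vec.map f t)

tuples : (m k : ℕ) → List (Vec (Fin m) k)
tuples m ℕ.zero    = [ [] ]
tuples m (suc k) = concatMap (λ i → map (i ∷_) (tuples m k)) (allFin m)

-- The (finite) atomic diagram of the substructure on {0,…,s}:
-- for each symbol, the truth values on all tuples from {0,…,s}.
FinDiagram : Signature → Set
FinDiagram σ = Vec (List Bool) (nSym σ)

-- S↾s is represented by the pair (s , restrict S s).
restrict : {σ : Signature} → Structure σ → ℕ → FinDiagram σ
restrict {σ} S s =
  tabulate (λ r → map (λ t → S r (Vec.map toℕ t)) (tuples (suc s) (ar σ r)))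

record Family (σ : Signature) : Set₁ where
  field
    I       : Set
    code    : I → ℕ
    codeInj : Injective _≡_ _≡_ code
    K       : I → Structure σ
    nonIso  : ∀ i j → i ≢ j → ¬ (K i ≅ K j)
open Family public

InLD : {σ : Signature} (𝔎 : Family σ) → Structure σ → Set
InLD 𝔎 S = Σ (I 𝔎) (λ j → S ≅ K 𝔎 j)

-- Hypothesis space HS(𝔎): just i = ⌜K i⌝, nothing = ?.
-- A learner maps finite substructures S↾s (given by s and their diagram) to hypotheses.
Learner : {σ : Signature} → Family σ → Set
Learner {σ} 𝔎 = ℕ → FinDiagram σ → Maybe (I 𝔎)

run : {σ : Signature} (𝔎 : Family σ) → Learner 𝔎 → Structure σ → ℕ → Maybe (I 𝔎)
run 𝔎 M S n = M n (restrict S n)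

ConvergesTo : {σ : Signature} (𝔎 : Family σ) → Learner 𝔎 → Structure σ → Maybe (I 𝔎) → Set
ConvergesTo 𝔎 M S h = Σ ℕ (λ n₀ → ∀ n → n₀ Data.Nat.≤ n → run 𝔎 M S n ≡ h)

ExLearns : {σ : Signature} (𝔎 : Family σ) → Learner 𝔎 → Set
ExLearns 𝔎 M = ∀ S → InLD 𝔎 S → ∀ (i : I 𝔎) →
  ConvergesTo 𝔎 M S (just i) ⇔ (S ≅ K 𝔎 i)

NUsLearns : {σ : Signature} (𝔎 : Family σ) → Learner 𝔎 → Set
NUsLearns 𝔎 M = ExLearns 𝔎 M ×
  (∀ S → InLD 𝔎 S → ∀ (i : I 𝔎) → S ≅ K 𝔎 i → ∀ n₀ →
     run 𝔎 M S n₀ ≡ just i → (∀ k → k < n₀ → run 𝔎 M S k ≢ just i) →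
     ∀ m → n₀ < m → run 𝔎 M S m ≡ just i)

DecLearns : {σ : Signature} (𝔎 : Family σ) → Learner 𝔎 → Set
DecLearns 𝔎 M = ExLearns 𝔎 M ×
  (∀ S → InLD 𝔎 S → ∀ (i : I 𝔎) → ∀ n →
     run 𝔎 M S n ≡ just i → run 𝔎 M S (suc n) ≢ just i →
     ∀ m → n < m → run 𝔎 M S m ≢ just i)

NUsLearnable : {σ : Signature} → Family σ → Set
NUsLearnable 𝔎 = Σ (Learner 𝔎) (NUsLearns 𝔎)

DecLearnable : {σ : Signature} → Family σ → Set
DecLearnable 𝔎 = Σ (Learner 𝔎) (DecLearns 𝔎)

-- A decisive learner is non-U-shaped: once it conjectures the correct index it can never
-- leave it, because it could not return to it and so would not converge.  Conversely, given a
-- non-U-shaped learner M, output M's conjecture h at stage n unless M has already switched away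
-- from h at some earlier stage, and ? otherwise.  M never abandons the correct index, so
-- convergence is unaffected, while an abandoned conjecture stays suppressed, which makes the
-- new learner decisive.  It can simulate M on S↾k for k ≤ n because S↾k is determined by the
-- finite diagram of S↾n (restrict-decode).
module Submission where

open import Defs
open import Function.Bundles using (_⇔_; mk⇔; mk↣; Equivalence)

open import Data.Bool using (Bool; true; false; not; _∧_; _∨_; if_then_else_)
open import Data.Bool.Properties using (∧-zeroʳ; ∨-zeroʳ)
open import Data.Empty using (⊥-elim)
open import Data.Fin using (Fin; toℕ; inject≤)
open import Data.Fin.Properties using (toℕ-inject≤)
open import Data.List using (List; _∷_; map)
open import Data.List.Membership.Propositional using (_∈_; lose)
open import Data.List.Membership.Propositional.Properties using (∈-map⁺; ∈-concatMap⁺; ∈-allFin)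
import Data.List.Properties as List
open import Data.List.Relation.Unary.Any using (Any; here; there)
open import Data.Maybe using (Maybe; just; nothing)
import Data.Maybe.Properties as Maybe
open import Data.Nat using (ℕ; zero; suc; _+_; _≤_; _<_; _≤′_; ≤′-refl; ≤′-step; s≤s)
open import Data.Nat.Induction using (<-rec)
open import Data.Nat.Properties
  using (_≟_; eq?; ≤-refl; ≤⇒≤′; <⇒≤; n<1+n; m<n⇒m<1+n; m<1+n⇒m<n∨m≡n; m≤m+n; m≤n+m; m≤n⇒m≤1+n)
open import Data.Product using (Σ; proj₁; _×_; _,_; ∃-syntax)
open import Data.Sum using (inj₁; inj₂)
open import Data.Vec using (Vec; []; _∷_)
import Data.Vec as Vec
import Data.Vec.Properties as Vec
open import Function using (_∘_)
open import Relation.Binary.Definitions using (DecidableEquality)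
open import Relation.Binary.PropositionalEquality
open import Relation.Nullary using (yes; no; does)
open import Relation.Nullary.Decidable using (dec-true; dec-false)

∈-tuples : ∀ {m k} (t : Vec (Fin m) k) → t ∈ tuples m k
∈-tuples []      = here refl
∈-tuples (i ∷ t) = ∈-concatMap⁺ _ (lose (∈-allFin i) (∈-map⁺ (i ∷_) (∈-tuples t)))

valueAt : ∀ {m a} → Vec ℕ a → List (Vec (Fin m) a) → List Bool → Bool
valueAt u (t ∷ ts) (b ∷ bs) = if does (Vec.≡-dec _≟_ (Vec.map toℕ t) u) then b else valueAt u ts bs
valueAt u _        _        = false

valueAt-map : ∀ {m a} (f : Vec ℕ a → Bool) {u} {ts : List (Vec (Fin m) a)} →
              Any (λ t → Vec.map toℕ t ≡ u) ts → valueAt u ts (map (f ∘ Vec.map toℕ) ts) ≡ f u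
valueAt-map f {u} {t ∷ _} p with Vec.≡-dec _≟_ (Vec.map toℕ t) u | p
... | yes t≡u | _        = cong f t≡u
... | no  t≢u | here t≡u = ⊥-elim (t≢u t≡u)
... | no  _   | there p′ = valueAt-map f p′

decode : (σ : Signature) → ℕ → FinDiagram σ → Structure σ
decode σ s D r u = valueAt u (tuples (suc s) (ar σ r)) (Vec.lookup D r)

restrict-decode : ∀ {σ} (S : Structure σ) {s k} → k ≤ s → restrict (decode σ s (restrict S s)) k ≡ restrict S k
restrict-decode {σ} S {s} k≤s = Vec.tabulate-cong λ r → List.map-cong (agree r) _
  where
  agree : ∀ r (t : Vec (Fin (suc _)) (ar σ r)) → decode σ s (restrict S s) r (Vec.map toℕ t) ≡ S r (Vec.map toℕ t)
  agree r t = begin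
    valueAt (Vec.map toℕ t) (tuples (suc s) (ar σ r)) (Vec.lookup (restrict S s) r)
      ≡⟨ cong (valueAt (Vec.map toℕ t) (tuples (suc s) (ar σ r))) (Vec.lookup∘tabulate _ r) ⟩
    valueAt (Vec.map toℕ t) (tuples (suc s) (ar σ r)) (map (S r ∘ Vec.map toℕ) (tuples (suc s) (ar σ r)))
      ≡⟨ valueAt-map (S r) (lose (∈-tuples t′) toℕ-t′) ⟩
    S r (Vec.map toℕ t) ∎
    where
    open ≡-Reasoning
    t′ = Vec.map (λ x → inject≤ x (s≤s k≤s)) t
    toℕ-t′ : Vec.map toℕ t′ ≡ Vec.map toℕ t
    toℕ-t′ = trans (sym (Vec.map-∘ toℕ _ t)) (Vec.map-cong (λ x → toℕ-inject≤ x (s≤s k≤s)) t)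

module HypothesisSequences {A : Set} (_≟ᴬ_ : DecidableEquality A) where

  _≟ᴴ_ : DecidableEquality (Maybe A)
  _≟ᴴ_ = Maybe.≡-dec _≟ᴬ_

  Eventually : (ℕ → Maybe A) → Maybe A → Set
  Eventually g h = Σ ℕ λ n₀ → ∀ n → n₀ ≤ n → g n ≡ h

  NonUShapedOn : (ℕ → Maybe A) → Maybe A → Set
  NonUShapedOn g h = ∀ n₀ → g n₀ ≡ h → (∀ k → k < n₀ → g k ≢ h) → ∀ m → n₀ < m → g m ≡ h

  DecisiveOn : (ℕ → Maybe A) → Maybe A → Set
  DecisiveOn g h = ∀ n → g n ≡ h → g (suc n) ≢ h → ∀ m → n < m → g m ≢ h

  Eventually-cong : ∀ {g g′ h} → (∀ n → g n ≡ g′ n) → Eventually g h → Eventually g′ h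
  Eventually-cong g≗g′ (n₀ , conv) = n₀ , λ n n₀≤n → trans (sym (g≗g′ n)) (conv n n₀≤n)

  DecisiveOn-cong : ∀ {g g′ h} → (∀ n → g n ≡ g′ n) → DecisiveOn g h → DecisiveOn g′ h
  DecisiveOn-cong g≗g′ dec n e ne m n<m em =
    dec n (trans (g≗g′ n) e) (ne ∘ trans (sym (g≗g′ (suc n)))) m n<m (trans (g≗g′ m) em)

  NonUShapedOn⇒persists : ∀ {g h} → NonUShapedOn g h → ∀ k → g k ≡ h → ∀ m → k < m → g m ≡ h
  NonUShapedOn⇒persists {g} {h} nus = <-rec _ persists
    where
    persists : ∀ k → (∀ {j} → j < k → g j ≡ h → ∀ m → j < m → g m ≡ h) → g k ≡ h → ∀ m → k < m → g m ≡ h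
    persists zero    _   e = nus zero e (λ _ ())
    persists (suc k) rec e with g k ≟ᴴ h
    ... | yes e′ = λ m k<m → rec (n<1+n k) e′ m (<⇒≤ k<m)
    ... | no  ne = nus (suc k) e first
      where
      -- an earlier occurrence of h would persist up to k, contradicting g k ≢ h
      first : ∀ j → j < suc k → g j ≢ h
      first j j<1+k ej with m<1+n⇒m<n∨m≡n j<1+k
      ... | inj₁ j<k  = ne (rec (m<n⇒m<1+n j<k) ej k j<k)
      ... | inj₂ refl = ne ej

  DecisiveOn⇒NonUShapedOn : ∀ {g h} → DecisiveOn g h → Eventually g h → NonUShapedOn g h
  DecisiveOn⇒NonUShapedOn {g} {h} dec (N , conv) n₀ e _ m n₀<m = persists (≤⇒≤′ (<⇒≤ n₀<m))
    where
    persists : ∀ {m} → n₀ ≤′ m → g m ≡ h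
    persists ≤′-refl = e
    persists (≤′-step {m} n₀≤′m) with g (suc m) ≟ᴴ h
    ... | yes e′ = e′
    ... | no  ne =
      ⊥-elim (dec m (persists n₀≤′m) ne (N + suc m) (m≤n+m (suc m) N) (conv (N + suc m) (m≤m+n N (suc m))))

  leaves : Maybe A → Maybe A → Maybe A → Bool
  leaves h x y = does (x ≟ᴴ h) ∧ not (does (y ≟ᴴ h))

  abandoned : (ℕ → Maybe A) → Maybe A → ℕ → Bool
  abandoned g h zero    = false
  abandoned g h (suc n) = abandoned g h n ∨ leaves h (g n) (g (suc n))

  abandoned-mono : ∀ {g h m n} → abandoned g h m ≡ true → m ≤ n → abandoned g h n ≡ true
  abandoned-mono {g} {h} p m≤n = go (≤⇒≤′ m≤n)
    where
    go : ∀ {n} → _ ≤′ n → abandoned g h n ≡ true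
    go ≤′-refl = p
    go (≤′-step m≤′n) rewrite go m≤′n = refl

  leaving⇒abandoned : ∀ {g h k} → g k ≡ h → g (suc k) ≢ h → abandoned g h (suc k) ≡ true
  leaving⇒abandoned {g} {h} {k} e ne
    rewrite dec-true (g k ≟ᴴ h) e | dec-false (g (suc k) ≟ᴴ h) ne = ∨-zeroʳ _

  abandoned⇒leaving : ∀ {g h} n → abandoned g h n ≡ true → ∃[ k ] k < n × g k ≡ h × g (suc k) ≢ h
  abandoned⇒leaving {g} {h} (suc n) p with abandoned g h n in eq | g n ≟ᴴ h | g (suc n) ≟ᴴ h
  ... | true  | _     | _      with abandoned⇒leaving n eq
  ...   | k , k<n , leaving = k , m<n⇒m<1+n k<n , leaving
  abandoned⇒leaving (suc n) p | false | yes e | no ne = n , n<1+n n , e , ne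

  abandoned-stable : ∀ {g h} n → abandoned g h n ≡ false → g (suc n) ≡ h → abandoned g h (suc n) ≡ false
  abandoned-stable {g} {h} n p e rewrite p | dec-true (g (suc n) ≟ᴴ h) e = ∧-zeroʳ _

  abandoned-cong : ∀ {g g′ h} n → (∀ k → k ≤ n → g k ≡ g′ k) → abandoned g h n ≡ abandoned g′ h n
  abandoned-cong zero    _    = refl
  abandoned-cong {h = h} (suc n) g≗g′ =
    cong₂ _∨_ (abandoned-cong n λ k k≤n → g≗g′ k (m≤n⇒m≤1+n k≤n))
              (cong₂ (leaves h) (g≗g′ n (m≤n⇒m≤1+n ≤-refl)) (g≗g′ (suc n) ≤-refl))

  NonUShapedOn⇒¬abandoned : ∀ {g h} → NonUShapedOn g h → ∀ n → abandoned g h n ≡ false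
  NonUShapedOn⇒¬abandoned {g} {h} nus n with abandoned g h n in eq
  ... | false = refl
  ... | true with abandoned⇒leaving n eq
  ...   | k , _ , e , ne = ⊥-elim (ne (NonUShapedOn⇒persists nus k e (suc k) (n<1+n k)))

  decisive : (ℕ → Maybe A) → ℕ → Maybe A
  decisive g n = if abandoned g (g n) n then nothing else g n

  decisive-just : ∀ {g a} n → decisive g n ≡ just a → g n ≡ just a × abandoned g (just a) n ≡ false
  decisive-just {g} n p with abandoned g (g n) n in eq
  ... | false = p , subst (λ x → abandoned g x n ≡ false) p eq

  decisive-keeps : ∀ {g a} n → g n ≡ just a → abandoned g (just a) n ≡ false → decisive g n ≡ just a
  decisive-keeps n e p rewrite e | p = refl

  decisive-cong : ∀ {g g′} n → (∀ k → k ≤ n → g k ≡ g′ k) → decisive g n ≡ decisive g′ n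
  decisive-cong {g} {g′} n g≗g′ rewrite g≗g′ n ≤-refl | abandoned-cong {h = g′ n} n g≗g′ = refl

  decisive-DecisiveOn : ∀ g a → DecisiveOn (decisive g) (just a)
  decisive-DecisiveOn g a n e ne m n<m em with decisive-just n e | decisive-just m em | g (suc n) ≟ᴴ just a
  ... | _      , ¬aban | _ , _      | yes e′ = ne (decisive-keeps (suc n) e′ (abandoned-stable n ¬aban e′))
  ... | gn≡a   , _     | _ , ¬abanₘ | no ne′
    with trans (sym (abandoned-mono (leaving⇒abandoned {g} gn≡a ne′) n<m)) ¬abanₘ
  ... | ()

  decisive-Eventually : ∀ {g a} → NonUShapedOn g (just a) → Eventually g (just a) → Eventually (decisive g) (just a)
  decisive-Eventually nus (n₀ , conv) =
    n₀ , λ n n₀≤n → decisive-keeps n (conv n n₀≤n) (NonUShapedOn⇒¬abandoned nus n)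

  Eventually-decisive : ∀ {g a} → Eventually (decisive g) (just a) → Eventually g (just a)
  Eventually-decisive (n₀ , conv) = n₀ , λ n n₀≤n → proj₁ (decisive-just n (conv n n₀≤n))

module _ {σ : Signature} (𝔎 : Family σ) where
  open HypothesisSequences (eq? (mk↣ (codeInj 𝔎)))

  decisiveLearner : Learner 𝔎 → Learner 𝔎
  decisiveLearner M s D = decisive (λ k → M k (restrict (decode σ s D) k)) s

  run-decisiveLearner : ∀ M S n → run 𝔎 (decisiveLearner M) S n ≡ decisive (run 𝔎 M S) n
  run-decisiveLearner M S n = decisive-cong n λ k k≤n → cong (M k) (restrict-decode S k≤n)

  NUsLearnable⇒DecLearnable : NUsLearnable 𝔎 → DecLearnable 𝔎
  NUsLearnable⇒DecLearnable (M , ex , nus) = decisiveLearner M , ex′ , dec′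
    where
    ex′ : ExLearns 𝔎 (decisiveLearner M)
    ex′ S S∈LD i = mk⇔
      (Equivalence.to (ex S S∈LD i) ∘ Eventually-decisive ∘ Eventually-cong (run-decisiveLearner M S))
      (λ S≅Kᵢ → Eventually-cong (sym ∘ run-decisiveLearner M S)
                  (decisive-Eventually (nus S S∈LD i S≅Kᵢ) (Equivalence.from (ex S S∈LD i) S≅Kᵢ)))

    dec′ : ∀ S → InLD 𝔎 S → ∀ i → DecisiveOn (run 𝔎 (decisiveLearner M) S) (just i)
    dec′ S _ i = DecisiveOn-cong (sym ∘ run-decisiveLearner M S) (decisive-DecisiveOn (run 𝔎 M S) i)

  DecLearnable⇒NUsLearnable : DecLearnable 𝔎 → NUsLearnable 𝔎
  DecLearnable⇒NUsLearnable (M , ex , dec) =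
    M , ex , λ S S∈LD i S≅Kᵢ → DecisiveOn⇒NonUShapedOn (dec S S∈LD i) (Equivalence.from (ex S S∈LD i) S≅Kᵢ)

mainTheorem4 : (σ : Signature) (𝔎 : Family σ) → NUsLearnable 𝔎 ⇔ DecLearnable 𝔎
mainTheorem4 σ 𝔎 = mk⇔ (NUsLearnable⇒DecLearnable 𝔎) (DecLearnable⇒NUsLearnable 𝔎)
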